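{- If a $(v,k,\lambda)$-BIBD admits a $0$-ULSE $\ell$-colouring, then $\lambda\geq \frac{k((\ell-1)^2-k)}{(\ell-1)^2}$.
   Context: For positive integers $v,k,\lambda$ with $2\le k<v$, a $(v,k,\lambda)$-BIBD is a pair $(V,\mathcal{B})$ where $V$ is a set of $v$ points and $\mathcal{B}$ is a collection of $k$-element subsets of $V$ (blocks) such that every pair of distinct points lies in exactly $\lambda$ blocks. An $\ell$-colouring is a surjective map from $V$ onto a set of $\ell$ colours. A $0$-ULSE $\ell$-colouring is an $\ell$-colouring such that $(\ell-1)$ divides $k$ and in every block exactly one colour does not appear, while each of the other $\ell-1$ colours appears exactly $\frac{k}{\ell-1}$ times in that block. -}

module Defs where

open import Data.Nat using (ℕ; _≤_; _<_; _*_)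
open import Data.Bool using (Bool; _∧_)
open import Data.Fin using (Fin; _≟_)
open import Data.Fin.Subset using (Subset; ∣_∣)
open import Data.Vec using (lookup; tabulate)
open import Data.List using (List; length; filterᵇ)
open import Data.List.Relation.Unary.All using (All)
open import Data.Product using (Σ; ∃; _×_)
open import Relation.Nullary using (¬_; ⌊_⌋)
open import Relation.Binary.PropositionalEquality using (_≡_)

-- Points are Fin v; a block is a subset of the points (Subset v = Vec Bool v);
-- the collection of blocks is a List (so repeated blocks are allowed).

pairCount : ∀ {v} → List (Subset v) → Fin v → Fin v → ℕ
pairCount 𝓑 i j = length (filterᵇ (λ B → lookup B i ∧ lookup B j) 𝓑)

record IsBIBD (v k lam : ℕ) (𝓑 : List (Subset v)) : Set where
  field
    k≥2       : 2 ≤ k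
    k<v       : k < v
    lam≥1     : 1 ≤ lam
    blockSize : All (λ B → ∣ B ∣ ≡ k) 𝓑
    balanced  : ∀ (i j : Fin v) → ¬ (i ≡ j) → pairCount 𝓑 i j ≡ lam

colourCount : ∀ {v ℓ} → (Fin v → Fin ℓ) → Subset v → Fin ℓ → ℕ
colourCount c B a = ∣ tabulate (λ x → lookup B x ∧ ⌊ c x ≟ a ⌋) ∣

IsColouring : ∀ {v} ℓ → (Fin v → Fin ℓ) → Set
IsColouring ℓ c = ∀ (a : Fin ℓ) → ∃ λ x → c x ≡ a

record Is0ULSE {v} (k ℓ : ℕ) (𝓑 : List (Subset v)) (c : Fin v → Fin ℓ) : Set where
  field
    colouring : IsColouring ℓ c
    q         : ℕ
    divides   : k ≡ q * (ℓ Data.Nat.∸ 1)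
    perBlock  : All (λ B → Σ (Fin ℓ) λ a →
                       (colourCount c B a ≡ 0) ×
                       (∀ b → ¬ (b ≡ a) → colourCount c B b ≡ q)) 𝓑

-- Let r be the replication number and m = ℓ - 1, so that k = qm. Fix a point w
-- of colour e: every block through w contains colour e, hence exactly q points
-- of it, so counting incidences between the blocks through w and the points of
-- colour e gives λ·|class e| + (r - λ) = qr. Summing over the ℓ colours and
-- using r(k - 1) = λ(v - 1) yields (m - q)r = mλ, whence
-- λm² - k(m² - k) = m(m - q)(r - k). It remains to show r ≥ k, which is
-- Fisher's inequality. We use the variance argument: for a fixed block W, the
-- squares (v·|B ∩ W| - k²)² summed over all blocks B are at least the term
-- (vk - k²)² of B = W, and evaluating the first two moments of |B ∩ W| turns
-- this into (v - 1)k ≤ vr, i.e. k ≤ r.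
module Submission where

open import Defs
open import Data.Bool using (Bool; true; false; _∧_)
open import Data.Nat as ℕ using (ℕ; zero; suc; _∸_; _^_; z≤n; s≤s)
import Data.Nat.Properties as ℕ
open import Data.Integer using (ℤ; +_; -[1+_]; 0ℤ; 1ℤ; _+_; _*_; _-_; -_; _≤_; _<_; _≥_; +≤+; +<+)
open import Data.Integer.Base using (positive; nonNegative; >-nonZero)
open import Data.Integer.Properties hiding (_≟_)
open import Data.Integer.Tactic.RingSolver using (solve-∀; solve)
open import Data.Fin using (Fin; zero; suc; _≟_; punchIn; fromℕ<)
open import Data.Fin.Properties using (punchInᵢ≢i; fromℕ<-injective)
open import Data.Fin.Subset using (Subset; ∣_∣)
open import Data.Vec as Vec using (tabulate)
open import Data.Vec.Properties using (lookup∘tabulate)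
open import Data.Vec.Functional using (removeAt)
open import Data.List as List using (List; []; _∷_; length; filterᵇ)
open import Data.List.Relation.Unary.All as All using (All)
open import Data.List.Membership.Propositional.Properties using (∈-lookup)
open import Data.Product using (_,_)
open import Data.Empty using (⊥-elim)
open import Function using (_∘_)
open import Relation.Nullary using (¬_; ⌊_⌋; yes; no)
open import Relation.Binary.PropositionalEquality
open import Algebra.Properties.Semiring.Sum +-*-semiring

𝟙 : Bool → ℤ
𝟙 true  = 1ℤ
𝟙 false = 0ℤ

𝟙-∧ : ∀ a b → 𝟙 (a ∧ b) ≡ 𝟙 a * 𝟙 b
𝟙-∧ true  b = sym (*-identityˡ (𝟙 b))
𝟙-∧ false b = refl

𝟙-idem : ∀ a → 𝟙 a * 𝟙 a ≡ 𝟙 a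
𝟙-idem true  = refl
𝟙-idem false = refl

𝟙-nonNeg : ∀ a → 0ℤ ≤ 𝟙 a
𝟙-nonNeg true  = +≤+ z≤n
𝟙-nonNeg false = +≤+ z≤n

𝟙-* : ∀ a {x y : ℤ} → (a ≡ true → x ≡ y) → 𝟙 a * x ≡ y * 𝟙 a
𝟙-* true  {x} {y} x≡y = trans (*-identityˡ x) (trans (x≡y refl) (sym (*-identityʳ y)))
𝟙-* false {x} {y} _   = sym (*-zeroʳ y)

δ : ∀ {n} → Fin n → Fin n → ℤ
δ x y = 𝟙 ⌊ x ≟ y ⌋

δ-refl : ∀ {n} (x : Fin n) → δ x x ≡ 1ℤ
δ-refl x with x ≟ x
... | yes _   = refl
... | no x≢x = ⊥-elim (x≢x refl)

δ-≢ : ∀ {n} {x y : Fin n} → x ≢ y → δ x y ≡ 0ℤ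
δ-≢ {x = x} {y} x≢y with x ≟ y
... | yes x≡y = ⊥-elim (x≢y x≡y)
... | no _    = refl

square-nonNeg : ∀ i → 0ℤ ≤ i * i
square-nonNeg (+ n)    = subst (0ℤ ≤_) (pos-* n n) (+≤+ z≤n)
square-nonNeg -[1+ n ] = +≤+ z≤n

*-nonNeg : ∀ {i j} → 0ℤ ≤ i → 0ℤ ≤ j → 0ℤ ≤ i * j
*-nonNeg {i} {j} 0≤i 0≤j =
  subst (_≤ i * j) (*-zeroʳ i) (*-monoˡ-≤-nonNeg i {{nonNegative 0≤i}} 0≤j)

*-pos : ∀ {i j} → 0ℤ < i → 0ℤ < j → 0ℤ < i * j
*-pos {i} {j} 0<i 0<j = subst (_< i * j) (*-zeroʳ i) (*-monoˡ-<-pos i {{positive 0<i}} 0<j)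

0≤i*j⇒0≤j : ∀ {i j} → 0ℤ < i → 0ℤ ≤ i * j → 0ℤ ≤ j
0≤i*j⇒0≤j {i} {j} 0<i 0≤ij =
  *-cancelˡ-≤-pos 0ℤ j i {{positive 0<i}} (subst (_≤ i * j) (sym (*-zeroʳ i)) 0≤ij)

i<j⇒0<j-i : ∀ {i j} → i < j → 0ℤ < j - i
i<j⇒0<j-i {i} {j} i<j = subst (_< j - i) (+-inverseʳ i) (+-monoˡ-< (- i) i<j)

≡-modulo : ∀ {x y a b} p → a ≡ b → x ≡ y + p * (a - b) → x ≡ y
≡-modulo {x} {y} {a} {b} p a≡b x≡y+p[a-b] = begin
  x                ≡⟨ x≡y+p[a-b] ⟩
  y + p * (a - b)  ≡⟨ cong (λ t → y + p * t) (i≡j⇒i-j≡0 a≡b) ⟩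
  y + p * 0ℤ       ≡⟨ cong (_+_ y) (*-zeroʳ p) ⟩
  y + 0ℤ           ≡⟨ +-identityʳ y ⟩
  y                ∎
  where open ≡-Reasoning

pos-square : ∀ m → + (m ^ 2) ≡ + m * + m
pos-square m = trans (pos-* m (m ^ 1)) (cong (λ t → + m * + t) (ℕ.*-identityʳ m))

∑-const : ∀ {n} c → ∑[ i < n ] c ≡ + n * c
∑-const {zero}  c = refl
∑-const {suc n} c = begin
  c + ∑[ i < n ] c  ≡⟨ cong (_+_ c) (∑-const {n} c) ⟩
  c + + n * c       ≡⟨ suc-* (+ n) c ⟨
  + suc n * c       ∎
  where open ≡-Reasoning

∑-nonNeg : ∀ {n} {f : Fin n → ℤ} → (∀ i → 0ℤ ≤ f i) → 0ℤ ≤ ∑[ i < n ] f i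
∑-nonNeg {zero}  _   = +≤+ z≤n
∑-nonNeg {suc n} 0≤f = +-mono-≤ (0≤f zero) (∑-nonNeg (0≤f ∘ suc))

term≤∑ : ∀ {n} {f : Fin n → ℤ} → (∀ i → 0ℤ ≤ f i) → ∀ i → f i ≤ ∑[ j < n ] f j
term≤∑ {suc n} {f} 0≤f i = subst (f i ≤_) (sym (sum-remove f))
  (i≤i+j (f i) _ {{nonNegative (∑-nonNeg (0≤f ∘ punchIn i))}})

∑-agree-except : ∀ {n} (z : Fin n) {f g : Fin n → ℤ} → (∀ y → y ≢ z → f y ≡ g y) →
                 ∑[ y < n ] f y ≡ ∑[ y < n ] g y + (f z - g z)
∑-agree-except {suc n} z {f} {g} f≗g = begin
  sum f                     ≡⟨ sum-remove f ⟩
  f z + sum (removeAt f z)  ≡⟨ cong (_+_ (f z)) (sum-cong-≗ (λ j → f≗g (punchIn z j) (punchInᵢ≢i z j))) ⟩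
  f z + S                   ≡⟨ shift (f z) (g z) S ⟩
  (g z + S) + (f z - g z)   ≡⟨ cong (_+ (f z - g z)) (sum-remove g) ⟨
  sum g + (f z - g z)       ∎
  where
  open ≡-Reasoning
  S = sum (removeAt g z)
  shift : ∀ a b s → a + s ≡ (b + s) + (a - b)
  shift = solve-∀

∑δ≡1 : ∀ {n} (x : Fin n) → ∑[ y < n ] δ x y ≡ 1ℤ
∑δ≡1 {n} x = begin
  ∑[ y < n ] δ x y                ≡⟨ ∑-agree-except x (λ y y≢x → δ-≢ (y≢x ∘ sym)) ⟩
  ∑[ y < n ] 0ℤ + (δ x x - 0ℤ)   ≡⟨ cong₂ (λ s d → s + (d - 0ℤ)) (sum-replicate-zero n) (δ-refl x) ⟩
  1ℤ                              ∎
  where open ≡-Reasoning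

∑-square-expand : ∀ {n} (a c : ℤ) (x : Fin n → ℤ) →
  ∑[ i < n ] ((a * x i - c) * (a * x i - c)) ≡
  a * a * ∑[ i < n ] (x i * x i) - + 2 * a * c * ∑[ i < n ] x i + c * c * + n
∑-square-expand {zero}  a c x = solve (a ∷ c ∷ [])
∑-square-expand {suc n} a c x = begin
  (a * x₀ - c) * (a * x₀ - c) + ∑[ i < n ] ((a * x (suc i) - c) * (a * x (suc i) - c))
    ≡⟨ cong (_+_ ((a * x₀ - c) * (a * x₀ - c))) (∑-square-expand a c (x ∘ suc)) ⟩
  (a * x₀ - c) * (a * x₀ - c) + (a * a * Q - + 2 * a * c * L + c * c * + n)
    ≡⟨ step a c x₀ Q L (+ n) ⟩
  a * a * (x₀ * x₀ + Q) - + 2 * a * c * (x₀ + L) + c * c * (1ℤ + + n)  ∎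
  where
  open ≡-Reasoning
  x₀ = x zero
  Q = ∑[ i < n ] (x (suc i) * x (suc i))
  L = ∑[ i < n ] x (suc i)
  step : ∀ a c x₀ Q L N → (a * x₀ - c) * (a * x₀ - c) + (a * a * Q - + 2 * a * c * L + c * c * N) ≡
                           a * a * (x₀ * x₀ + Q) - + 2 * a * c * (x₀ + L) + c * c * (1ℤ + N)
  step = solve-∀

∣p∣-as-∑ : ∀ {n} (p : Subset n) → + ∣ p ∣ ≡ ∑[ y < n ] 𝟙 (Vec.lookup p y)
∣p∣-as-∑ Vec.[]          = refl
∣p∣-as-∑ (true  Vec.∷ p) = cong (_+_ 1ℤ) (∣p∣-as-∑ p)
∣p∣-as-∑ (false Vec.∷ p) = trans (∣p∣-as-∑ p) (sym (+-identityˡ _))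

length-filterᵇ-as-∑ : ∀ {A : Set} (p : A → Bool) (xs : List A) →
  + length (filterᵇ p xs) ≡ ∑[ i < length xs ] 𝟙 (p (List.lookup xs i))
length-filterᵇ-as-∑ p []       = refl
length-filterᵇ-as-∑ p (x ∷ xs) with p x
... | true  = cong (_+_ 1ℤ) (length-filterᵇ-as-∑ p xs)
... | false = trans (length-filterᵇ-as-∑ p xs) (sym (+-identityˡ _))

[v-1]k≤vr⇒k≤r : ∀ {v k r} → 0ℤ < k → k < v → (v - 1ℤ) * k ≤ v * r → k ≤ r
[v-1]k≤vr⇒k≤r {v} {k} {r} 0<k k<v [v-1]k≤vr =
  subst (_≤ r) (unpred k) (i<j⇒suc[i]≤j (*-cancelˡ-<-nonNeg v {{0≤v}} (suc[i]≤j⇒i<j 1+v[k-1]≤vr)))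
  where
  0≤v = nonNegative (<⇒≤ (<-trans 0<k k<v))
  unpred : ∀ k → 1ℤ + (k - 1ℤ) ≡ k
  unpred = solve-∀
  regroup : ∀ v k → 1ℤ + v * (k - 1ℤ) ≡ (v - 1ℤ) * k + ((1ℤ + k) - v)
  regroup = solve-∀
  1+v[k-1]≤vr : 1ℤ + v * (k - 1ℤ) ≤ v * r
  1+v[k-1]≤vr = begin
    1ℤ + v * (k - 1ℤ)              ≡⟨ regroup v k ⟩
    (v - 1ℤ) * k + ((1ℤ + k) - v)  ≤⟨ +-monoʳ-≤ ((v - 1ℤ) * k) (i≤j⇒i-j≤0 (i<j⇒suc[i]≤j k<v)) ⟩
    (v - 1ℤ) * k + 0ℤ              ≡⟨ +-identityʳ _ ⟩
    (v - 1ℤ) * k                   ≤⟨ [v-1]k≤vr ⟩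
    v * r                          ∎
    where open ≤-Reasoning

fisher-bound : ∀ {v k lam r b} → 0ℤ < k → k < v → b * k ≡ v * r → r * (k - 1ℤ) ≡ lam * (v - 1ℤ) →
  (v * k - k * k) * (v * k - k * k) ≤
    v * v * (lam * k * k + (r - lam) * k) - + 2 * v * (k * k) * (r * k) + k * k * (k * k) * b →
  k ≤ r
fisher-bound {v} {k} {lam} {r} {b} 0<k k<v bk≡vr r[k-1]≡λ[v-1] sq≤Q =
  [v-1]k≤vr⇒k≤r 0<k k<v (0≤i-j⇒j≤i (0≤i*j⇒0≤j 0<c (subst (0ℤ ≤_) identity [v-1][Q-sq]≥0)))
  where
  Q = v * v * (lam * k * k + (r - lam) * k) - + 2 * v * (k * k) * (r * k) + k * k * (k * k) * b
  sq = (v * k - k * k) * (v * k - k * k)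
  c = k * ((v - k) * (v - k))
  0<c : 0ℤ < c
  0<c = *-pos 0<k (*-pos (i<j⇒0<j-i k<v) (i<j⇒0<j-i k<v))
  [v-1][Q-sq]≥0 : 0ℤ ≤ (v - 1ℤ) * (Q - sq)
  [v-1][Q-sq]≥0 = *-nonNeg (i≤j⇒0≤j-i (i<j⇒suc[i]≤j (<-trans 0<k k<v))) (i≤j⇒0≤j-i sq≤Q)
  polynomial-identity : ∀ v k lam r b →
    (v - 1ℤ) * ((v * v * (lam * k * k + (r - lam) * k) - + 2 * v * (k * k) * (r * k) + k * k * (k * k) * b)
                - (v * k - k * k) * (v * k - k * k)) ≡
    k * ((v - k) * (v - k)) * (v * r - (v - 1ℤ) * k)
      + (v - 1ℤ) * (k * k * k) * (b * k - v * r) + v * v * k * (k - 1ℤ) * (lam * (v - 1ℤ) - r * (k - 1ℤ))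
  polynomial-identity = solve-∀
  identity : (v - 1ℤ) * (Q - sq) ≡ c * (v * r - (v - 1ℤ) * k)
  identity = ≡-modulo ((v - 1ℤ) * (k * k * k)) bk≡vr
               (≡-modulo (v * v * k * (k - 1ℤ)) (sym r[k-1]≡λ[v-1]) (polynomial-identity v k lam r b))

ulse-bound : ∀ m q lam {r k} → k ≡ q * m → (m - q) * r ≡ m * lam →
  0ℤ ≤ m → 0ℤ ≤ lam → 0ℤ < k → k ≤ r → k * (m * m - k) ≤ lam * (m * m)
ulse-bound m q lam {r} refl ratio 0≤m 0≤lam 0<k k≤r =
  0≤i-j⇒j≤i (subst (0ℤ ≤_) (sym identity) (*-nonNeg 0≤m (*-nonNeg 0≤m-q (i≤j⇒0≤j-i k≤r))))
  where
  0≤m-q : 0ℤ ≤ m - q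
  0≤m-q = 0≤i*j⇒0≤j (<-≤-trans 0<k k≤r)
            (subst (0ℤ ≤_) (trans (sym ratio) (*-comm (m - q) r)) (*-nonNeg 0≤m 0≤lam))
  polynomial-identity : ∀ m q lam r →
    lam * (m * m) - q * m * (m * m - q * m) ≡ m * ((m - q) * (r - q * m)) + (- m) * ((m - q) * r - m * lam)
  polynomial-identity = solve-∀
  identity : lam * (m * m) - q * m * (m * m - q * m) ≡ m * ((m - q) * (r - q * m))
  identity = ≡-modulo (- m) ratio (polynomial-identity m q lam r)

module Incidence {v : ℕ} (𝓑 : List (Subset v)) where

  b : ℕ
  b = length 𝓑

  block : Fin b → Subset v
  block = List.lookup 𝓑

  inc : Fin v → Fin b → ℤ
  inc y β = 𝟙 (Vec.lookup (block β) y)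

  replication : Fin v → ℤ
  replication y = ∑[ β < b ] inc y β

  ∑-swap-incidence : ∀ (g : Fin b → ℤ) (f : Fin v → ℤ) →
    ∑[ β < b ] (g β * ∑[ y < v ] (inc y β * f y)) ≡ ∑[ y < v ] (∑[ β < b ] (g β * inc y β) * f y)
  ∑-swap-incidence g f = begin
    ∑[ β < b ] (g β * ∑[ y < v ] (inc y β * f y))
      ≡⟨ sum-cong-≗ (λ β → *-distribˡ-sum (g β) (λ y → inc y β * f y)) ⟩
    ∑[ β < b ] ∑[ y < v ] (g β * (inc y β * f y))
      ≡⟨ ∑-comm (λ β y → g β * (inc y β * f y)) ⟩
    ∑[ y < v ] ∑[ β < b ] (g β * (inc y β * f y))
      ≡⟨ sum-cong-≗ (λ y → sum-cong-≗ (λ β → *-assoc (g β) (inc y β) (f y))) ⟨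
    ∑[ y < v ] ∑[ β < b ] (g β * inc y β * f y)
      ≡⟨ sum-cong-≗ (λ y → *-distribʳ-sum (f y) (λ β → g β * inc y β)) ⟨
    ∑[ y < v ] (∑[ β < b ] (g β * inc y β) * f y)
      ∎
    where open ≡-Reasoning

module Design {v k lam : ℕ} {𝓑 : List (Subset v)} (D : IsBIBD v k lam 𝓑) where

  open IsBIBD D
  open Incidence 𝓑 public

  pair-count : ∀ {z y} → z ≢ y → ∑[ β < b ] (inc z β * inc y β) ≡ + lam
  pair-count {z} {y} z≢y = begin
    ∑[ β < b ] (inc z β * inc y β)
      ≡⟨ sum-cong-≗ (λ β → 𝟙-∧ (Vec.lookup (block β) z) (Vec.lookup (block β) y)) ⟨
    ∑[ β < b ] 𝟙 (Vec.lookup (block β) z ∧ Vec.lookup (block β) y)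
      ≡⟨ length-filterᵇ-as-∑ _ 𝓑 ⟨
    + pairCount 𝓑 z y
      ≡⟨ cong +_ (balanced z y z≢y) ⟩
    + lam
      ∎
    where open ≡-Reasoning

  pair-count-diagonal : ∀ z → ∑[ β < b ] (inc z β * inc z β) ≡ replication z
  pair-count-diagonal z = sum-cong-≗ (λ β → 𝟙-idem (Vec.lookup (block β) z))

  block-size : ∀ β → ∑[ y < v ] inc y β ≡ + k
  block-size β = trans (sym (∣p∣-as-∑ (block β))) (cong +_ (All.lookup blockSize (∈-lookup β)))

  block-size-*1 : ∀ β → ∑[ y < v ] (inc y β * 1ℤ) ≡ + k
  block-size-*1 β = trans (sum-cong-≗ (λ y → *-identityʳ (inc y β))) (block-size β)

  weighted-pair-count : ∀ z (f : Fin v → ℤ) →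
    ∑[ β < b ] (inc z β * ∑[ y < v ] (inc y β * f y)) ≡ + lam * ∑[ y < v ] f y + (replication z - + lam) * f z
  weighted-pair-count z f = begin
    ∑[ β < b ] (inc z β * ∑[ y < v ] (inc y β * f y))
      ≡⟨ ∑-swap-incidence (inc z) f ⟩
    ∑[ y < v ] (∑[ β < b ] (inc z β * inc y β) * f y)
      ≡⟨ ∑-agree-except z (λ y y≢z → cong (_* f y) (pair-count (y≢z ∘ sym))) ⟩
    ∑[ y < v ] (+ lam * f y) + (∑[ β < b ] (inc z β * inc z β) * f z - + lam * f z)
      ≡⟨ cong₂ (λ s t → s + (t * f z - + lam * f z)) (*-distribˡ-sum (+ lam) f) (sym (pair-count-diagonal z)) ⟨
    + lam * ∑[ y < v ] f y + (replication z * f z - + lam * f z)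
      ≡⟨ cong (_+_ (+ lam * ∑[ y < v ] f y)) (factor (replication z) (+ lam) (f z)) ⟩
    + lam * ∑[ y < v ] f y + (replication z - + lam) * f z
      ∎
    where
    open ≡-Reasoning
    factor : ∀ r l x → r * x - l * x ≡ (r - l) * x
    factor = solve-∀

  r[k-1]≡λ[v-1] : ∀ z → replication z * (+ k - 1ℤ) ≡ + lam * (+ v - 1ℤ)
  r[k-1]≡λ[v-1] z = ≡-modulo 1ℤ incidences (regroup (replication z) (+ k) (+ lam) (+ v))
    where
    regroup : ∀ r k l v → r * (k - 1ℤ) ≡ l * (v - 1ℤ) + 1ℤ * (r * k - (l * (v * 1ℤ) + (r - l) * 1ℤ))
    regroup = solve-∀
    incidences : replication z * + k ≡ + lam * (+ v * 1ℤ) + (replication z - + lam) * 1ℤ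
    incidences = begin
      replication z * + k
        ≡⟨ *-distribʳ-sum (+ k) (inc z) ⟩
      ∑[ β < b ] (inc z β * + k)
        ≡⟨ sum-cong-≗ (λ β → cong (inc z β *_) (sym (block-size-*1 β))) ⟩
      ∑[ β < b ] (inc z β * ∑[ y < v ] (inc y β * 1ℤ))
        ≡⟨ weighted-pair-count z (λ _ → 1ℤ) ⟩
      + lam * ∑[ y < v ] 1ℤ + (replication z - + lam) * 1ℤ
        ≡⟨ cong (λ s → + lam * s + (replication z - + lam) * 1ℤ) (∑-const {v} 1ℤ) ⟩
      + lam * (+ v * 1ℤ) + (replication z - + lam) * 1ℤ
        ∎
      where open ≡-Reasoning

  replication-constant : ∀ y z → replication y ≡ replication z
  replication-constant y z =
    *-cancelʳ-≡ _ _ (+ k - 1ℤ) {{>-nonZero (i<j⇒0<j-i (+<+ k≥2))}}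
      (trans (r[k-1]≡λ[v-1] y) (sym (r[k-1]≡λ[v-1] z)))

  double-count : ∀ z (f : Fin v → ℤ) →
    ∑[ β < b ] ∑[ y < v ] (inc y β * f y) ≡ replication z * ∑[ y < v ] f y
  double-count z f = begin
    ∑[ β < b ] ∑[ y < v ] (inc y β * f y)  ≡⟨ ∑-comm (λ β y → inc y β * f y) ⟩
    ∑[ y < v ] ∑[ β < b ] (inc y β * f y)  ≡⟨ sum-cong-≗ (λ y → *-distribʳ-sum (f y) (λ β → inc y β)) ⟨
    ∑[ y < v ] (replication y * f y)      ≡⟨ sum-cong-≗ (λ y → cong (_* f y) (replication-constant y z)) ⟩
    ∑[ y < v ] (replication z * f y)      ≡⟨ *-distribˡ-sum (replication z) f ⟨
    replication z * ∑[ y < v ] f y        ∎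
    where open ≡-Reasoning

  bk≡vr : ∀ z → + b * + k ≡ + v * replication z
  bk≡vr z = begin
    + b * + k                               ≡⟨ ∑-const {b} (+ k) ⟨
    ∑[ β < b ] (+ k)                        ≡⟨ sum-cong-≗ (λ β → sym (block-size-*1 β)) ⟩
    ∑[ β < b ] ∑[ y < v ] (inc y β * 1ℤ)    ≡⟨ double-count z (λ _ → 1ℤ) ⟩
    replication z * ∑[ y < v ] 1ℤ           ≡⟨ cong (replication z *_) (∑-const {v} 1ℤ) ⟩
    replication z * (+ v * 1ℤ)              ≡⟨ cong (replication z *_) (*-identityʳ (+ v)) ⟩
    replication z * + v                     ≡⟨ *-comm (replication z) (+ v) ⟩
    + v * replication z                     ∎
    where open ≡-Reasoning

  meet : Fin b → Fin b → ℤ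
  meet β γ = ∑[ y < v ] (inc y β * inc y γ)

  meet-self : ∀ β → meet β β ≡ + k
  meet-self β = trans (sum-cong-≗ (λ y → 𝟙-idem (Vec.lookup (block β) y))) (block-size β)

  ∑-meet : ∀ γ z → ∑[ β < b ] meet β γ ≡ replication z * + k
  ∑-meet γ z = trans (double-count z (λ y → inc y γ)) (cong (replication z *_) (block-size γ))

  ∑-meet² : ∀ γ z → ∑[ β < b ] (meet β γ * meet β γ) ≡ + lam * + k * + k + (replication z - + lam) * + k
  ∑-meet² γ z = begin
    ∑[ β < b ] (meet β γ * meet β γ)
      ≡⟨ ∑-swap-incidence (λ β → meet β γ) (λ y → inc y γ) ⟩
    ∑[ y < v ] (∑[ β < b ] (meet β γ * inc y β) * inc y γ)
      ≡⟨ sum-cong-≗ (λ y → cong (_* inc y γ) (weighted y)) ⟩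
    ∑[ y < v ] ((λk + ρ * inc y γ) * inc y γ)
      ≡⟨ sum-cong-≗ (λ y → absorb λk ρ (inc y γ) (𝟙-idem (Vec.lookup (block γ) y))) ⟩
    ∑[ y < v ] ((λk + ρ) * inc y γ)
      ≡⟨ *-distribˡ-sum (λk + ρ) (λ y → inc y γ) ⟨
    (λk + ρ) * ∑[ y < v ] inc y γ
      ≡⟨ cong ((λk + ρ) *_) (block-size γ) ⟩
    (λk + ρ) * + k
      ≡⟨ *-distribʳ-+ (+ k) λk ρ ⟩
    + lam * + k * + k + (replication z - + lam) * + k
      ∎
    where
    open ≡-Reasoning
    λk = + lam * + k
    ρ = replication z - + lam
    absorb-identity : ∀ a c x → (a + c * x) * x ≡ (a + c) * x + c * (x * x - x)
    absorb-identity = solve-∀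
    absorb : ∀ a c x → x * x ≡ x → (a + c * x) * x ≡ (a + c) * x
    absorb a c x idem = ≡-modulo c idem (absorb-identity a c x)
    weighted : ∀ y → ∑[ β < b ] (meet β γ * inc y β) ≡ λk + ρ * inc y γ
    weighted y = begin
      ∑[ β < b ] (meet β γ * inc y β)
        ≡⟨ sum-cong-≗ (λ β → *-comm (meet β γ) (inc y β)) ⟩
      ∑[ β < b ] (inc y β * meet β γ)
        ≡⟨ weighted-pair-count y (λ x → inc x γ) ⟩
      + lam * ∑[ x < v ] inc x γ + (replication y - + lam) * inc y γ
        ≡⟨ cong₂ (λ s r → + lam * s + (r - + lam) * inc y γ) (block-size γ) (replication-constant y z) ⟩
      λk + ρ * inc y γ
        ∎

  0<k : 0ℤ < + k
  0<k = +<+ (ℕ.≤-trans (s≤s z≤n) k≥2)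

  -- Fisher's inequality v ≤ b, in the equivalent form k ≤ r (as bk = vr).
  fisher-inequality : Fin b → ∀ z → + k ≤ replication z
  fisher-inequality W z = fisher-bound {lam = + lam} 0<k (+<+ k<v) (bk≡vr z) (r[k-1]≡λ[v-1] z) variance
    where
    r = replication z
    v' = + v
    kk = + k * + k
    variance : (v' * + k - kk) * (v' * + k - kk) ≤
               v' * v' * (+ lam * + k * + k + (r - + lam) * + k) - + 2 * v' * kk * (r * + k) + kk * kk * + b
    variance = begin
      (v' * + k - kk) * (v' * + k - kk)
        ≡⟨ cong (λ t → (v' * t - kk) * (v' * t - kk)) (meet-self W) ⟨
      (v' * meet W W - kk) * (v' * meet W W - kk)
        ≤⟨ term≤∑ (λ β → square-nonNeg (v' * meet β W - kk)) W ⟩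
      ∑[ β < b ] ((v' * meet β W - kk) * (v' * meet β W - kk))
        ≡⟨ ∑-square-expand v' kk (λ β → meet β W) ⟩
      v' * v' * ∑[ β < b ] (meet β W * meet β W) - + 2 * v' * kk * ∑[ β < b ] meet β W + kk * kk * + b
        ≡⟨ cong₂ (λ s t → v' * v' * s - + 2 * v' * kk * t + kk * kk * + b) (∑-meet² W z) (∑-meet W z) ⟩
      v' * v' * (+ lam * + k * + k + (r - + lam) * + k) - + 2 * v' * kk * (r * + k) + kk * kk * + b
        ∎
      where open ≤-Reasoning

module Colouring {v k lam m : ℕ} {𝓑 : List (Subset v)} {c : Fin v → Fin (suc m)}
                 (D : IsBIBD v k lam 𝓑) (U : Is0ULSE k (suc m) 𝓑 c) where

  open Design D public
  open Is0ULSE U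

  k≡q*m : + k ≡ + q * + m
  k≡q*m = trans (cong +_ divides) (pos-* q m)

  classSize : Fin (suc m) → ℤ
  classSize e = ∑[ y < v ] δ (c y) e

  ∑-classSize : ∑[ e < suc m ] classSize e ≡ + v
  ∑-classSize = begin
    ∑[ e < suc m ] ∑[ y < v ] δ (c y) e  ≡⟨ ∑-comm (λ e y → δ (c y) e) ⟩
    ∑[ y < v ] ∑[ e < suc m ] δ (c y) e  ≡⟨ sum-cong-≗ (λ y → ∑δ≡1 (c y)) ⟩
    ∑[ y < v ] 1ℤ                        ≡⟨ ∑-const {v} 1ℤ ⟩
    + v * 1ℤ                             ≡⟨ *-identityʳ (+ v) ⟩
    + v                                  ∎
    where open ≡-Reasoning

  colourCount-as-∑ : ∀ β e → + colourCount c (block β) e ≡ ∑[ y < v ] (inc y β * δ (c y) e)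
  colourCount-as-∑ β e = trans (∣p∣-as-∑ (tabulate colour-e∈β)) (sum-cong-≗ λ y →
    trans (cong 𝟙 (lookup∘tabulate colour-e∈β y)) (𝟙-∧ (Vec.lookup (block β) y) ⌊ c y ≟ e ⌋))
    where
    colour-e∈β : Fin v → Bool
    colour-e∈β y = Vec.lookup (block β) y ∧ ⌊ c y ≟ e ⌋

  inc≤colourCount : ∀ w β → inc w β ≤ + colourCount c (block β) (c w)
  inc≤colourCount w β = begin
    inc w β                                ≡⟨ *-identityʳ (inc w β) ⟨
    inc w β * 1ℤ                           ≡⟨ cong (inc w β *_) (δ-refl (c w)) ⟨
    inc w β * δ (c w) (c w)
      ≤⟨ term≤∑ (λ y → *-nonNeg (𝟙-nonNeg (Vec.lookup (block β) y)) (𝟙-nonNeg ⌊ c y ≟ c w ⌋)) w ⟩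
    ∑[ y < v ] (inc y β * δ (c y) (c w))   ≡⟨ colourCount-as-∑ β (c w) ⟨
    + colourCount c (block β) (c w)        ∎
    where open ≤-Reasoning

  colourCount-present : ∀ {w β} → Vec.lookup (block β) w ≡ true → colourCount c (block β) (c w) ≡ q
  colourCount-present {w} {β} w∈β with All.lookup perBlock (∈-lookup β)
  ... | a , absent , others with c w ≟ a
  ...   | no cw≢a  = others (c w) cw≢a
  ...   | yes refl = ⊥-elim (1≰0 (subst (λ n → 1ℤ ≤ + n) absent 1≤count))
    where
    1≤count : 1ℤ ≤ + colourCount c (block β) (c w)
    1≤count = subst (_≤ + colourCount c (block β) (c w)) (cong 𝟙 w∈β) (inc≤colourCount w β)
    1≰0 : ¬ 1ℤ ≤ 0ℤ
    1≰0 (+≤+ ())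

  incidences-with-class : ∀ z e → + q * replication z ≡ + lam * classSize e + (replication z - + lam)
  incidences-with-class z e with colouring e
  ... | w , refl = begin
    + q * replication z
      ≡⟨ cong (+ q *_) (replication-constant z w) ⟩
    + q * replication w
      ≡⟨ *-distribˡ-sum (+ q) (inc w) ⟩
    ∑[ β < b ] (+ q * inc w β)
      ≡⟨ sum-cong-≗ (λ β → 𝟙-* (Vec.lookup (block β) w) (cong +_ ∘ colourCount-present)) ⟨
    ∑[ β < b ] (inc w β * + colourCount c (block β) (c w))
      ≡⟨ sum-cong-≗ (λ β → cong (inc w β *_) (colourCount-as-∑ β (c w))) ⟩
    ∑[ β < b ] (inc w β * ∑[ y < v ] (inc y β * δ (c y) (c w)))
      ≡⟨ weighted-pair-count w (λ y → δ (c y) (c w)) ⟩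
    + lam * classSize (c w) + (replication w - + lam) * δ (c w) (c w)
      ≡⟨ cong₂ (λ r d → + lam * classSize (c w) + (r - + lam) * d) (replication-constant w z) (δ-refl (c w)) ⟩
    + lam * classSize (c w) + (replication z - + lam) * 1ℤ
      ≡⟨ cong (_+_ (+ lam * classSize (c w))) (*-identityʳ (replication z - + lam)) ⟩
    + lam * classSize (c w) + (replication z - + lam)
      ∎
    where open ≡-Reasoning

  replication-ratio : ∀ z → (+ m - + q) * replication z ≡ + m * + lam
  replication-ratio z =
    ≡-modulo 1ℤ colour-sum (≡-modulo 1ℤ r[qm-1]≡λ[v-1] (polynomial-identity (+ m) (+ q) (+ lam) r (+ v)))
    where
    polynomial-identity : ∀ m q lam r v →
      (m - q) * r ≡ m * lam + 1ℤ * ((lam * v + (1ℤ + m) * (r - lam)) - (1ℤ + m) * (q * r))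
                            + 1ℤ * (r * (q * m - 1ℤ) - lam * (v - 1ℤ))
    polynomial-identity = solve-∀
    r = replication z
    r[qm-1]≡λ[v-1] : r * (+ q * + m - 1ℤ) ≡ + lam * (+ v - 1ℤ)
    r[qm-1]≡λ[v-1] = subst (λ t → r * (t - 1ℤ) ≡ + lam * (+ v - 1ℤ)) k≡q*m (r[k-1]≡λ[v-1] z)
    colour-sum : + lam * + v + (1ℤ + + m) * (r - + lam) ≡ (1ℤ + + m) * (+ q * r)
    colour-sum = begin
      + lam * + v + + suc m * (r - + lam)
        ≡⟨ cong₂ (λ s t → + lam * s + t) ∑-classSize (∑-const {suc m} (r - + lam)) ⟨
      + lam * ∑[ e < suc m ] classSize e + ∑[ e < suc m ] (r - + lam)
        ≡⟨ cong (_+ ∑[ e < suc m ] (r - + lam)) (*-distribˡ-sum (+ lam) classSize) ⟩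
      ∑[ e < suc m ] (+ lam * classSize e) + ∑[ e < suc m ] (r - + lam)
        ≡⟨ ∑-distrib-+ (λ e → + lam * classSize e) (λ _ → r - + lam) ⟨
      ∑[ e < suc m ] (+ lam * classSize e + (r - + lam))
        ≡⟨ sum-cong-≗ (λ e → sym (incidences-with-class z e)) ⟩
      ∑[ e < suc m ] (+ q * r)
        ≡⟨ ∑-const {suc m} (+ q * r) ⟩
      + suc m * (+ q * r)
        ∎
      where open ≡-Reasoning

bibd-point : ∀ {v k lam 𝓑} → IsBIBD v k lam 𝓑 → Fin v
bibd-point D = fromℕ< (ℕ.≤-trans (s≤s z≤n) (ℕ.≤-trans k≥2 (ℕ.<⇒≤ k<v)))
  where open IsBIBD D

bibd-block : ∀ {v k lam 𝓑} → IsBIBD v k lam 𝓑 → Fin (length 𝓑)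
bibd-block {𝓑 = _ ∷ _} D = zero
bibd-block {𝓑 = []}    D = ⊥-elim (ℕ.<-irrefl (balanced first second first≢second) lam≥1)
  where
  open IsBIBD D
  1<v = ℕ.≤-trans k≥2 (ℕ.<⇒≤ k<v)
  first = fromℕ< (ℕ.<⇒≤ 1<v)
  second = fromℕ< 1<v
  first≢second : first ≢ second
  first≢second = (λ ()) ∘ fromℕ<-injective 0 1 (ℕ.<⇒≤ 1<v) 1<v

corollary3p12 : ∀ (v k lam ℓ : ℕ) (𝓑 : List (Subset v)) (c : Fin v → Fin ℓ) →
    IsBIBD v k lam 𝓑 → Is0ULSE k ℓ 𝓑 c →
    (+ lam) * (+ ((ℓ ∸ 1) ^ 2)) ≥ (+ k) * ((+ ((ℓ ∸ 1) ^ 2)) - (+ k))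
corollary3p12 v k lam zero    𝓑 c D U with c (bibd-point D)
... | ()
corollary3p12 v k lam (suc m) 𝓑 c D U =
  subst (λ M → + k * (M - + k) ≤ + lam * M) (sym (pos-square m))
    (ulse-bound (+ m) (+ q) (+ lam) k≡q*m (replication-ratio z) (+≤+ z≤n) (+≤+ z≤n) 0<k
      (fisher-inequality (bibd-block D) z))
  where
  open Colouring D U
  open Is0ULSE U using (q)
  z = bibd-point D
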